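{- For integers $k\ge3$ and $n\ge2$, let $Wd(k,n)$ be the windmill graph and $\Delta$ its maximum degree. Then $\chi_r(Wd(k,n))=k$ if $2\le r\le k-1$, and $\chi_r(Wd(k,n))=\min\{r,\Delta\}+1$ if $r\ge k$ (with $r\le\Delta$).
   Context: The windmill graph $Wd(k,n)$ consists of $n$ copies of the complete graph $K_k$ with one vertex from each copy identified into a single common center vertex. All graphs are simple, connected and undirected; $N_G(v)$ is the open neighborhood, $d(v)=|N_G(v)|$, $\Delta$ the maximum degree. For a coloring $c$ and vertex set $S$, $c(S)=\{c(u):u\in S\}$. For integers $k'>0$ and $0<r\le\Delta(G)$ with $r\le k'$, a conditional $(k',r)$-coloring of $G$ is a surjective map $c:V(G)\to\{1,\dots,k'\}$ such that (C1) $c(u)\ne c(v)$ whenever $uv\in E(G)$, and (C2) $|c(N_G(v))|\ge\min\{d(v),r\}$ for every vertex $v$. $\chi_r(G)$ is the smallest $k'$ for which $G$ has a conditional $(k',r)$-coloring. -}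

module Defs where

open import Data.Nat using (ℕ; zero; suc; _+_; _*_; _∸_; _≤_; _⊔_)
open import Data.Fin using (Fin; quotient)
import Data.Fin as Fin
open import Data.Bool using (Bool; true; false; if_then_else_; _∧_; _∨_; not)
open import Data.Product using (Σ; ∃; _×_; _,_)
open import Relation.Binary.PropositionalEquality using (_≡_; _≢_)
open import Relation.Nullary.Decidable using (⌊_⌋)
open import Function.Definitions using (Surjective)

-- A finite graph on vertex set Fin N, given by a Boolean adjacency relation.
-- (Simplicity, i.e. symmetry and irreflexivity, holds for the concrete
-- windmill graph below by construction.)
record Graph : Set where
  field
    N   : ℕ
    adj : Fin N → Fin N → Bool
open Graph public

count : (m : ℕ) → (Fin m → Bool) → ℕ
count zero    p = 0
count (suc m) p = (if p Fin.zero then 1 else 0) + count m (λ i → p (Fin.suc i))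

anyFin : (m : ℕ) → (Fin m → Bool) → Bool
anyFin zero    p = false
anyFin (suc m) p = p Fin.zero ∨ anyFin m (λ i → p (Fin.suc i))

maxFin : (m : ℕ) → (Fin m → ℕ) → ℕ
maxFin zero    f = 0
maxFin (suc m) f = f Fin.zero ⊔ maxFin m (λ i → f (Fin.suc i))

deg : (G : Graph) → Fin (N G) → ℕ
deg G v = count (N G) (adj G v)

maxDeg : (G : Graph) → ℕ
maxDeg G = maxFin (N G) (deg G)

-- |c(N_G(v))| for a coloring c with colours Fin k (colour j stands for j+1)
numNbrColours : (G : Graph) {k : ℕ} → (Fin (N G) → Fin k) → Fin (N G) → ℕ
numNbrColours G {k} c v =
  count k (λ j → anyFin (N G) (λ u → adj G v u ∧ ⌊ c u Fin.≟ j ⌋))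

-- conditional (k,r)-colouring (colours {1..k} represented by Fin k);
-- the side conditions 0 < r ≤ Δ(G) and r ≤ k of the definition are included.
record IsConditionalColouring (G : Graph) (k r : ℕ) (c : Fin (N G) → Fin k) : Set where
  field
    r-pos      : 1 ≤ r
    r≤Δ        : r ≤ maxDeg G
    r≤k        : r ≤ k
    surjective : ∀ (j : Fin k) → ∃ λ v → c v ≡ j
    proper     : ∀ u v → adj G u v ≡ true → c u ≢ c v
    condition  : ∀ v → Data.Nat._⊓_ (deg G v) r ≤ numNbrColours G c v

HasConditionalColouring : Graph → ℕ → ℕ → Set
HasConditionalColouring G k r = Σ (Fin (N G) → Fin k) (IsConditionalColouring G k r)

ChiR≡ : Graph → ℕ → ℕ → Set
ChiR≡ G r m = HasConditionalColouring G m r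
            × (∀ k → HasConditionalColouring G k r → m ≤ k)

-- Windmill graph Wd(k,n): vertex 0 is the centre; vertex suc i
-- (i : Fin (n * (k ∸ 1))) lies in blade  quotient (k ∸ 1) i : Fin n.
Wd : ℕ → ℕ → Graph
Wd k n = record { N = suc (n * (k ∸ 1)) ; adj = a }
  where
  a : Fin (suc (n * (k ∸ 1))) → Fin (suc (n * (k ∸ 1))) → Bool
  a Fin.zero    Fin.zero    = false
  a Fin.zero    (Fin.suc _) = true
  a (Fin.suc _) Fin.zero    = true
  a (Fin.suc i) (Fin.suc j) =
    not ⌊ i Fin.≟ j ⌋ ∧ ⌊ quotient {n} (k ∸ 1) i Fin.≟ quotient {n} (k ∸ 1) j ⌋

module Submission where

-- The centre together with one blade is a clique K_k, so at least k colours are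
-- needed; and the centre is adjacent to all Δ other vertices, so for r ≤ Δ it must
-- see r colours different from its own, forcing r + 1 colours.  Conversely, give the
-- centre its own colour and colour each blade injectively from a common palette of
-- m = max(k-1, r) colours, using all of them: every vertex then sees distinct colours
-- on its neighbours, and the centre sees the whole palette.

open import Defs
open import Data.Nat using (ℕ; _≤_; _∸_; _+_; _⊓_)
open import Data.Product using (_×_)
open import Data.Nat using (zero; suc; _<_; _*_; z≤n; s≤s; _<?_; >-nonZero)
open import Data.Nat.Properties hiding (_≟_)
open import Data.Fin as F using (Fin; toℕ; fromℕ<; quotient; remainder; combine; _≟_)
import Data.Fin.Properties as FP
open import Data.Bool using (Bool; true; false; _∧_; not)
open import Data.Bool.Properties using (∧-identityʳ)
open import Data.Product using (∃; ∃₂; _,_; proj₁; proj₂)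
open import Data.Sum using (_⊎_; inj₁; inj₂)
open import Data.Empty using (⊥-elim)
open import Function using (_∘_; id)
open import Function.Definitions using (Injective)
open import Relation.Binary.PropositionalEquality
open import Relation.Nullary using (yes; no)
open import Relation.Nullary.Decidable using (⌊_⌋; ⌊⌋-map′)

≟-true⇒≡ : ∀ {m} {x y : Fin m} → ⌊ x ≟ y ⌋ ≡ true → x ≡ y
≟-true⇒≡ {x = x} {y} e with x ≟ y | e
... | yes x≡y | _ = x≡y
... | no _    | ()

≟-refl : ∀ {m} (x : Fin m) → ⌊ x ≟ x ⌋ ≡ true
≟-refl x with x ≟ x
... | yes _   = refl
... | no x≢x = ⊥-elim (x≢x refl)

∧-true⇒ : ∀ {a b} → a ∧ b ≡ true → a ≡ true × b ≡ true
∧-true⇒ {true} {true} _ = refl , refl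

count-cong : ∀ m {p q : Fin m → Bool} → (∀ x → p x ≡ q x) → count m p ≡ count m q
count-cong zero    p≗q = refl
count-cong (suc m) p≗q rewrite p≗q F.zero = cong (_ +_) (count-cong m (p≗q ∘ F.suc))

count-true : ∀ m → count m (λ _ → true) ≡ m
count-true zero    = refl
count-true (suc m) = cong suc (count-true m)

count-≤ : ∀ m (p : Fin m → Bool) → count m p ≤ m
count-≤ zero    p = z≤n
count-≤ (suc m) p with p F.zero
... | true  = s≤s (count-≤ m (p ∘ F.suc))
... | false = m≤n⇒m≤1+n (count-≤ m (p ∘ F.suc))

count-< : ∀ m (p : Fin m → Bool) (x : Fin m) → p x ≡ false → count m p < m
count-< (suc m) p F.zero    px rewrite px = s≤s (count-≤ m (p ∘ F.suc))
count-< (suc m) p (F.suc x) px with p F.zero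
... | true  = s≤s (count-< m (p ∘ F.suc) x px)
... | false = m≤n⇒m≤1+n (count-< m (p ∘ F.suc) x px)

count-remove : ∀ m (p : Fin m → Bool) (y : Fin m) → p y ≡ true →
               count m p ≡ suc (count m (λ x → p x ∧ not ⌊ x ≟ y ⌋))
count-remove (suc m) p F.zero py rewrite py =
  cong suc (count-cong m (λ x → sym (∧-identityʳ (p (F.suc x)))))
count-remove (suc m) p (F.suc y) py
  rewrite ∧-identityʳ (p F.zero) | count-remove m (p ∘ F.suc) y py =
  trans (+-suc _ _) (cong (suc ∘ (_ +_)) (count-cong m λ x →
    cong (λ b → p (F.suc x) ∧ not b) (sym (⌊⌋-map′ (cong F.suc) FP.suc-injective (x ≟ y)))))

count-mono-injective : ∀ a b (p : Fin a → Bool) (q : Fin b → Bool) (g : Fin a → Fin b) →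
  (∀ x → p x ≡ true → q (g x) ≡ true) →
  (∀ x y → p x ≡ true → p y ≡ true → g x ≡ g y → x ≡ y) →
  count a p ≤ count b q
count-mono-injective zero    b p q g maps inj = z≤n
count-mono-injective (suc a) b p q g maps inj with p F.zero in p0
... | false = count-mono-injective a b (p ∘ F.suc) q (g ∘ F.suc) (maps ∘ F.suc) inj′
  where inj′ = λ x y px py gx≡gy → FP.suc-injective (inj (F.suc x) (F.suc y) px py gx≡gy)
... | true rewrite count-remove b q (g F.zero) (maps F.zero p0) =
  s≤s (count-mono-injective a b (p ∘ F.suc) q′ (g ∘ F.suc) maps′ inj′)
  where
  q′ : Fin b → Bool
  q′ y = q y ∧ not ⌊ y ≟ g F.zero ⌋
  inj′ = λ x y px py gx≡gy → FP.suc-injective (inj (F.suc x) (F.suc y) px py gx≡gy)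
  maps′ : ∀ x → p (F.suc x) ≡ true → q′ (g (F.suc x)) ≡ true
  maps′ x px with g (F.suc x) ≟ g F.zero
  ... | yes gx≡g0 = ⊥-elim (FP.0≢1+n (sym (inj (F.suc x) F.zero px p0 gx≡g0)))
  ... | no _ rewrite maps (F.suc x) px = refl

anyFin-intro : ∀ m (p : Fin m → Bool) (x : Fin m) → p x ≡ true → anyFin m p ≡ true
anyFin-intro (suc m) p F.zero    px rewrite px = refl
anyFin-intro (suc m) p (F.suc x) px with p F.zero
... | true  = refl
... | false = anyFin-intro m (p ∘ F.suc) x px

anyFin-elim : ∀ m (p : Fin m → Bool) → anyFin m p ≡ true → ∃ λ x → p x ≡ true
anyFin-elim (suc m) p any with p F.zero in p0
... | true  = F.zero , p0
... | false with anyFin-elim m (p ∘ F.suc) any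
...   | x , px = F.suc x , px

maxFin-lub : ∀ m (f : Fin m → ℕ) {b} → (∀ x → f x ≤ b) → maxFin m f ≤ b
maxFin-lub zero    f f≤b = z≤n
maxFin-lub (suc m) f f≤b = ⊔-lub (f≤b F.zero) (maxFin-lub m (f ∘ F.suc) (f≤b ∘ F.suc))

Proper : (G : Graph) {k : ℕ} → (Fin (N G) → Fin k) → Set
Proper G c = ∀ u v → adj G u v ≡ true → c u ≢ c v

module _ (G : Graph) {k : ℕ} (c : Fin (N G) → Fin k) where

  colourSeenAt : Fin (N G) → Fin k → Bool
  colourSeenAt v j = anyFin (N G) (λ u → adj G v u ∧ ⌊ c u ≟ j ⌋)

  colourSeenAt-nbr : ∀ {v u} → adj G v u ≡ true → colourSeenAt v (c u) ≡ true
  colourSeenAt-nbr {v} {u} vu = anyFin-intro (N G) _ u (cong₂ _∧_ vu (≟-refl (c u)))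

  deg≤numNbrColours : ∀ v →
    (∀ u u′ → adj G v u ≡ true → adj G v u′ ≡ true → c u ≡ c u′ → u ≡ u′) →
    deg G v ≤ numNbrColours G c v
  deg≤numNbrColours v inj =
    count-mono-injective (N G) k (adj G v) (colourSeenAt v) c (λ _ → colourSeenAt-nbr) inj

  ≤numNbrColours : ∀ v t (g : Fin t → Fin k) → Injective _≡_ _≡_ g →
    (∀ j → ∃ λ u → adj G v u ≡ true × c u ≡ g j) → t ≤ numNbrColours G c v
  ≤numNbrColours v t g g-inj seen = subst (_≤ numNbrColours G c v) (count-true t)
    (count-mono-injective t k (λ _ → true) (colourSeenAt v) g
      (λ j _ → let (u , vu , cu≡gj) = seen j in
               subst (λ j′ → colourSeenAt v j′ ≡ true) cu≡gj (colourSeenAt-nbr vu))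
      (λ _ _ _ _ → g-inj))

  numNbrColours<k : Proper G c → ∀ v → numNbrColours G c v < k
  numNbrColours<k proper v = count-< k (colourSeenAt v) (c v) unseen
    where
    unseen : colourSeenAt v (c v) ≡ false
    unseen with colourSeenAt v (c v) in seen
    ... | false = refl
    ... | true with anyFin-elim (N G) _ seen
    ...   | u , vu∧cu≡cv with ∧-true⇒ vu∧cu≡cv
    ...     | vu , cu≡cv = ⊥-elim (proper v u vu (sym (≟-true⇒≡ cu≡cv)))

  clique-size≤colours : Proper G c → ∀ t (w : Fin t → Fin (N G)) →
    (∀ x y → x ≢ y → adj G (w x) (w y) ≡ true) → t ≤ k
  clique-size≤colours proper t w clique = FP.injective⇒≤ {f = c ∘ w} c∘w-injective
    where
    c∘w-injective : Injective _≡_ _≡_ (c ∘ w)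
    c∘w-injective {x} {y} cwx≡cwy with x ≟ y
    ... | yes x≡y = x≡y
    ... | no  x≢y = ⊥-elim (proper (w x) (w y) (clique x y x≢y) cwx≡cwy)

  suc-r≤colours : ∀ {r} → IsConditionalColouring G k r c → ∀ v → r ≤ deg G v → suc r ≤ k
  suc-r≤colours {r} cc v r≤deg = ≤-trans (s≤s r≤numNbr) (numNbrColours<k proper v)
    where
    open IsConditionalColouring cc using (proper; condition)
    r≤numNbr : r ≤ numNbrColours G c v
    r≤numNbr = ≤-trans (≤-reflexive (sym (m≥n⇒m⊓n≡n r≤deg))) (condition v)

module Windmill (K n : ℕ) where

  G : Graph
  G = Wd (suc K) n

  blade : Fin (n * K) → Fin n
  blade = quotient {n} K

  position : Fin (n * K) → Fin K
  position = remainder {n} K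

  blade-combine : ∀ b ρ → blade (combine b ρ) ≡ b
  blade-combine b ρ = cong proj₁ (FP.remQuot-combine {n} {K} b ρ)

  position-combine : ∀ b ρ → position (combine b ρ) ≡ ρ
  position-combine b ρ = cong proj₂ (FP.remQuot-combine {n} {K} b ρ)

  blade-position-injective : ∀ {i j} → blade i ≡ blade j → position i ≡ position j → i ≡ j
  blade-position-injective {i} {j} bi≡bj pi≡pj = begin
    i                                ≡⟨ FP.combine-remQuot {n} K i ⟨
    combine (blade i) (position i)   ≡⟨ cong₂ combine bi≡bj pi≡pj ⟩
    combine (blade j) (position j)   ≡⟨ FP.combine-remQuot {n} K j ⟩
    j                                ∎
    where open ≡-Reasoning

  toℕ-blade-position : ∀ i → toℕ i ≡ K * toℕ (blade i) + toℕ (position i)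
  toℕ-blade-position i =
    trans (cong toℕ (sym (FP.combine-remQuot {n} K i))) (FP.toℕ-combine (blade i) (position i))

  adj⇒sameBlade : ∀ i j → adj G (F.suc i) (F.suc j) ≡ true → i ≢ j × blade i ≡ blade j
  adj⇒sameBlade i j ij with i ≟ j | blade i ≟ blade j | ij
  ... | no i≢j | yes bi≡bj | _ = i≢j , bi≡bj
  ... | yes _  | _         | ()
  ... | no _   | no _      | ()

  sameBlade⇒adj : ∀ i j → i ≢ j → blade i ≡ blade j → adj G (F.suc i) (F.suc j) ≡ true
  sameBlade⇒adj i j i≢j bi≡bj with i ≟ j | blade i ≟ blade j
  ... | no _    | yes _     = refl
  ... | yes i≡j | _         = ⊥-elim (i≢j i≡j)
  ... | no _    | no bi≢bj  = ⊥-elim (bi≢bj bi≡bj)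

  deg-centre : deg G F.zero ≡ n * K
  deg-centre = count-true (n * K)

  deg-blade< : ∀ i → deg G (F.suc i) < N G
  deg-blade< i = count-< (N G) (adj G (F.suc i)) (F.suc i) not-loop
    where
    not-loop : adj G (F.suc i) (F.suc i) ≡ false
    not-loop rewrite ≟-refl i = refl

  maxDeg-Wd : maxDeg G ≡ n * K
  maxDeg-Wd = ≤-antisym (maxFin-lub (N G) (deg G) deg≤)
                        (subst (_≤ maxDeg G) deg-centre (m≤m⊔n _ _))
    where
    deg≤ : ∀ v → deg G v ≤ n * K
    deg≤ F.zero    = ≤-reflexive deg-centre
    deg≤ (F.suc i) = ≤-pred (deg-blade< i)

  bladeClique : Fin n → Fin (suc K) → Fin (N G)
  bladeClique b F.zero    = F.zero
  bladeClique b (F.suc ρ) = F.suc (combine b ρ)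

  bladeClique-adj : ∀ b x y → x ≢ y → adj G (bladeClique b x) (bladeClique b y) ≡ true
  bladeClique-adj b F.zero    F.zero    x≢y = ⊥-elim (x≢y refl)
  bladeClique-adj b F.zero    (F.suc y) _   = refl
  bladeClique-adj b (F.suc x) F.zero    _   = refl
  bladeClique-adj b (F.suc x) (F.suc y) x≢y = sameBlade⇒adj _ _
    (λ eq → x≢y (cong F.suc (trans (sym (position-combine b x))
                               (trans (cong position eq) (position-combine b y)))))
    (trans (blade-combine b x) (sym (blade-combine b y)))

  suc-K≤colours : Fin n → ∀ {m} (c : Fin (N G) → Fin m) → Proper G c → suc K ≤ m
  suc-K≤colours b c proper = clique-size≤colours G c proper (suc K) (bladeClique b) (bladeClique-adj b)

  module BladeColouring {m} (g : Fin n → Fin K → Fin m)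
                       (g-injective : ∀ b → Injective _≡_ _≡_ (g b))
                       (g-surjective : ∀ j → ∃₂ λ b ρ → g b ρ ≡ j) where

    colour : Fin (N G) → Fin (suc m)
    colour F.zero    = F.zero
    colour (F.suc i) = F.suc (g (blade i) (position i))

    colour-combine : ∀ b ρ → colour (F.suc (combine b ρ)) ≡ F.suc (g b ρ)
    colour-combine b ρ = cong₂ (λ b′ ρ′ → F.suc (g b′ ρ′)) (blade-combine b ρ) (position-combine b ρ)

    sameBlade-sameColour⇒≡ : ∀ i j → blade i ≡ blade j → colour (F.suc i) ≡ colour (F.suc j) → i ≡ j
    sameBlade-sameColour⇒≡ i j bi≡bj ci≡cj = blade-position-injective bi≡bj
      (g-injective (blade j) (subst (λ b → g b (position i) ≡ _) bi≡bj (FP.suc-injective ci≡cj)))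

    colour-surjective : ∀ j → ∃ λ v → colour v ≡ j
    colour-surjective F.zero    = F.zero , refl
    colour-surjective (F.suc j) with g-surjective j
    ... | b , ρ , gbρ≡j = F.suc (combine b ρ) , trans (colour-combine b ρ) (cong F.suc gbρ≡j)

    colour-proper : Proper G colour
    colour-proper F.zero    F.zero    ()
    colour-proper F.zero    (F.suc _) _  ()
    colour-proper (F.suc _) F.zero    _  ()
    colour-proper (F.suc i) (F.suc j) ij ci≡cj =
      let (i≢j , bi≡bj) = adj⇒sameBlade i j ij in i≢j (sameBlade-sameColour⇒≡ i j bi≡bj ci≡cj)

    nbrColours-injective : ∀ i u u′ → adj G (F.suc i) u ≡ true → adj G (F.suc i) u′ ≡ true →
                           colour u ≡ colour u′ → u ≡ u′
    nbrColours-injective i F.zero    F.zero     _   _    _     = refl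
    nbrColours-injective i F.zero    (F.suc _)  _   _    ()
    nbrColours-injective i (F.suc _) F.zero     _   _    ()
    nbrColours-injective i (F.suc j) (F.suc j′) ij  ij′  cj≡cj′ = cong F.suc
      (sameBlade-sameColour⇒≡ j j′
        (trans (sym (proj₂ (adj⇒sameBlade i j ij))) (proj₂ (adj⇒sameBlade i j′ ij′))) cj≡cj′)

    m≤numNbrColours-centre : m ≤ numNbrColours G colour F.zero
    m≤numNbrColours-centre = ≤numNbrColours G colour F.zero m F.suc FP.suc-injective seen
      where
      seen : ∀ j → ∃ λ u → adj G F.zero u ≡ true × colour u ≡ F.suc j
      seen j with g-surjective j
      ... | b , ρ , gbρ≡j = F.suc (combine b ρ) , refl , trans (colour-combine b ρ) (cong F.suc gbρ≡j)

    colour-condition : ∀ {r} → r ≤ m → ∀ v → deg G v ⊓ r ≤ numNbrColours G colour v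
    colour-condition {r} r≤m F.zero    = ≤-trans (m⊓n≤n _ r) (≤-trans r≤m m≤numNbrColours-centre)
    colour-condition {r} _   (F.suc i) =
      ≤-trans (m⊓n≤m _ r) (deg≤numNbrColours G colour (F.suc i) (nbrColours-injective i))

    isConditionalColouring : ∀ {r} → 1 ≤ r → r ≤ n * K → r ≤ m →
                             IsConditionalColouring G (suc m) r colour
    isConditionalColouring 1≤r r≤nK r≤m = record
      { r-pos      = 1≤r
      ; r≤Δ        = subst (_ ≤_) (sym maxDeg-Wd) r≤nK
      ; r≤k        = m≤n⇒m≤1+n r≤m
      ; surjective = colour-surjective
      ; proper     = colour-proper
      ; condition  = colour-condition r≤m
      }

  -- For K < r: position ρ of blade b is numbered K·b + ρ, and numbers ≥ r fall back to ρ.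
  module Folded {r} (K<r : K < r) where

    index : Fin n → Fin K → ℕ
    index b ρ = K * toℕ b + toℕ ρ

    folded : Fin n → Fin K → Fin r
    folded b ρ with index b ρ <? r
    ... | yes idx<r = fromℕ< idx<r
    ... | no _      = fromℕ< (<-trans (FP.toℕ<n ρ) K<r)

    toℕ-folded : ∀ b ρ → (index b ρ < r × toℕ (folded b ρ) ≡ index b ρ)
                       ⊎ (r ≤ index b ρ × toℕ (folded b ρ) ≡ toℕ ρ)
    toℕ-folded b ρ with index b ρ <? r
    ... | yes idx<r = inj₁ (idx<r , FP.toℕ-fromℕ< idx<r)
    ... | no  idx≮r = inj₂ (≮⇒≥ idx≮r , FP.toℕ-fromℕ< (<-trans (FP.toℕ<n ρ) K<r))

    -- Within one blade, a number below r never equals a fallback value: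
    -- in blade 0 nothing falls back, and in the other blades the numbers are ≥ K.
    index≢fallback : ∀ b ρ ρ′ → r ≤ index b ρ′ → index b ρ ≢ toℕ ρ′
    index≢fallback b ρ ρ′ r≤idx idx≡ρ′ with toℕ b
    ... | zero   = <-irrefl refl (<-≤-trans (<-trans (FP.toℕ<n ρ′) K<r)
                     (subst (r ≤_) (cong (_+ toℕ ρ′) (*-zeroʳ K)) r≤idx))
    ... | suc b′ = <-irrefl refl (<-≤-trans (FP.toℕ<n ρ′)
                     (≤-trans (m≤m*n K (suc b′)) (≤-trans (m≤m+n _ (toℕ ρ)) (≤-reflexive idx≡ρ′))))

    folded-injective : ∀ b → Injective _≡_ _≡_ (folded b)
    folded-injective b {ρ} {ρ′} eq with toℕ-folded b ρ | toℕ-folded b ρ′ | cong toℕ eq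
    ... | inj₁ (_ , fρ) | inj₁ (_ , fρ′) | e =
      FP.toℕ-injective (+-cancelˡ-≡ (K * toℕ b) _ _ (trans (sym fρ) (trans e fρ′)))
    ... | inj₂ (_ , fρ) | inj₂ (_ , fρ′) | e = FP.toℕ-injective (trans (sym fρ) (trans e fρ′))
    ... | inj₁ (_ , fρ) | inj₂ (r≤ , fρ′) | e =
      ⊥-elim (index≢fallback b ρ ρ′ r≤ (trans (sym fρ) (trans e fρ′)))
    ... | inj₂ (r≤ , fρ) | inj₁ (_ , fρ′) | e =
      ⊥-elim (index≢fallback b ρ′ ρ r≤ (trans (sym fρ′) (trans (sym e) fρ)))

    folded-surjective : r ≤ n * K → ∀ j → ∃₂ λ b ρ → folded b ρ ≡ j
    folded-surjective r≤nK j = blade i , position i , FP.toℕ-injective toℕ-folded≡j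
      where
      j<nK : toℕ j < n * K
      j<nK = <-≤-trans (FP.toℕ<n j) r≤nK
      i : Fin (n * K)
      i = fromℕ< j<nK
      index≡j : index (blade i) (position i) ≡ toℕ j
      index≡j = trans (sym (toℕ-blade-position i)) (FP.toℕ-fromℕ< j<nK)
      toℕ-folded≡j : toℕ (folded (blade i) (position i)) ≡ toℕ j
      toℕ-folded≡j with toℕ-folded (blade i) (position i)
      ... | inj₁ (_ , f≡idx) = trans f≡idx index≡j
      ... | inj₂ (r≤idx , _) = ⊥-elim (<-irrefl refl
              (<-≤-trans (FP.toℕ<n j) (≤-trans r≤idx (≤-reflexive index≡j))))

  χ-below-k : Fin n → ∀ r → 1 ≤ r → r ≤ K → ChiR≡ G r (suc K)
  χ-below-k b r 1≤r r≤K =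
      (colour , isConditionalColouring 1≤r (≤-trans r≤K K≤nK) r≤K)
    , λ m (c , cc) → suc-K≤colours b c (IsConditionalColouring.proper cc)
    where
    open BladeColouring (λ _ ρ → ρ) (λ _ → id) (λ ρ → b , ρ , refl)
    K≤nK : K ≤ n * K
    K≤nK = m≤n*m K n ⦃ >-nonZero (≤-trans (s≤s z≤n) (FP.toℕ<n b)) ⦄

  χ-above-k : ∀ r → K < r → r ≤ n * K → ChiR≡ G r (suc r)
  χ-above-k r K<r r≤nK =
      (colour , isConditionalColouring (≤-trans (s≤s z≤n) K<r) r≤nK ≤-refl)
    , λ m (c , cc) → suc-r≤colours G c cc F.zero (subst (r ≤_) (sym deg-centre) r≤nK)
    where
    open Folded K<r
    open BladeColouring folded folded-injective (folded-surjective r≤nK)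

proposition3p3 : ∀ (k n r : ℕ) → 3 ≤ k → 2 ≤ n →
    ((2 ≤ r → r ≤ k ∸ 1 → ChiR≡ (Wd k n) r k)
    × (k ≤ r → r ≤ maxDeg (Wd k n) → ChiR≡ (Wd k n) r ((r ⊓ maxDeg (Wd k n)) + 1)))
proposition3p3 (suc K) (suc n) r (s≤s (s≤s (s≤s _))) (s≤s (s≤s _)) =
  (λ 2≤r r≤K → χ-below-k F.zero r (≤-trans (s≤s z≤n) 2≤r) r≤K) ,
  (λ K<r r≤Δ → subst (ChiR≡ G r) (sym (min+1≡suc r≤Δ))
                  (χ-above-k r K<r (subst (r ≤_) maxDeg-Wd r≤Δ)))
  where
  open Windmill K (suc n)
  min+1≡suc : r ≤ maxDeg G → r ⊓ maxDeg G + 1 ≡ suc r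
  min+1≡suc r≤Δ = trans (cong (_+ 1) (m≤n⇒m⊓n≡m r≤Δ)) (+-comm r 1)
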